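{- Let $M$ be a regular $n\times n$ matrix over $\mathbb{F}_2$ (the adjacency matrix of a reflexive directed graph). Define the sequence $M_0=M$ and $M_{i+1}=d(M_i)$ for $i\ge 0$. Then the sequence is purely periodic: the least $p\ge 0$ for which there is $q>p$ with $M_p=M_q$ is $p=0$; equivalently, there exists $q\ge 1$ with $M_q=M_0$.
   Context: A matrix is regular if all its diagonal entries equal $1$. For an $n\times n$ matrix $M$ over $\mathbb{F}_2$, the matrix $d(M)$ is defined by the following procedure. Start with $D:=M$. For $i=1,2,\dots,n$ in this order: set $D_{i,i}:=0$; then for every $k>i$ with $D_{k,i}=1$, replace the row $D_k$ by $D_k+D_i$ (entrywise, mod $2$); then set $D_{i,i}:=1$. The final matrix $D$ is $d(M)$; it is regular. -}

module Defs where

open import Data.Bool using (Bool; true; false; _xor_; if_then_else_)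
open import Data.Nat using (ℕ; zero; suc; _<_)
open import Data.Nat.Properties using (_<?_)
open import Data.Fin using (Fin; toℕ)
open import Data.Fin.Properties using () renaming (_≟_ to _≟F_)
open import Data.Vec using (Vec; lookup; updateAt; zipWith; tabulate; _[_]≔_; allFin)
open import Data.Vec as V using ()
open import Data.Product using (∃; _×_)
open import Relation.Binary.PropositionalEquality using (_≡_)
open import Relation.Nullary using (does)

-- Matrices over F₂ = Bool with xor as addition; row-major, indexed by Fin n.
Matrix : ℕ → Set
Matrix n = Vec (Vec Bool n) n

entry : ∀ {n} → Matrix n → Fin n → Fin n → Bool
entry M i j = lookup (lookup M i) j

Regular : ∀ {n} → Matrix n → Set
Regular {n} M = (i : Fin n) → entry M i i ≡ true

setEntry : ∀ {n} → Matrix n → Fin n → Fin n → Bool → Matrix n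
setEntry M i j b = M [ i ]≔ (lookup M i [ j ]≔ b)

addRow : ∀ {n} → Vec Bool n → Vec Bool n → Vec Bool n
addRow = zipWith _xor_

-- for every k > i with D_{k,i} = 1, replace row D_k by D_k + D_i.
-- (All these updates use the same row D_i, which is not itself modified,
--  and each test D_{k,i} only concerns row k, so they may be done simultaneously.)
eliminateBelow : ∀ {n} → Matrix n → Fin n → Matrix n
eliminateBelow {n} D i =
  tabulate λ k →
    if does (toℕ i <? toℕ k) then
      (if entry D k i then addRow (lookup D k) (lookup D i) else lookup D k)
    else lookup D k

step : ∀ {n} → Matrix n → Fin n → Matrix n
step D i = setEntry (eliminateBelow (setEntry D i i false) i) i i true

d : ∀ {n} → Matrix n → Matrix n
d {n} M = V.foldl (λ _ → Matrix n) step M (allFin n)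

iterate : ∀ {n} → ℕ → Matrix n → Matrix n
iterate zero M = M
iterate (suc i) M = d (iterate i M)

module Submission where

open import Defs
open import Data.Bool using (Bool; true; false; _xor_; _∧_; if_then_else_)
open import Data.Bool.Properties using (xor-assoc; xor-same; xor-identityʳ; ∧-zeroʳ)
open import Data.Fin using (Fin; toℕ; funToFin; finToFun) renaming (_<_ to _<ᶠ_)
import Data.Fin as Fin
open import Data.Fin.Properties using (pigeonhole; finToFun-funToFin; 2↔Bool) renaming (_≟_ to _≟ᶠ_)
open import Data.Nat using (ℕ; zero; suc; _<_; _≥_; _^_; s≤s; z≤n)
open import Data.Nat.Properties using (_<?_; <-irrefl; <-asym; n<1+n)
open import Data.Product using (∃; ∃₂; _×_; _,_)
open import Data.Sum using (_⊎_; inj₁; inj₂)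
open import Data.Vec using (Vec; []; _∷_; lookup; tabulate; foldl; allFin)
open import Data.Vec.Properties using (lookup∘tabulate; lookup∘update; lookup∘update′; lookup-zipWith)
open import Data.Vec.Relation.Binary.Pointwise.Extensional using (ext; Pointwise-≡⇒≡)
open import Function using (id; _∘_)
open import Function.Bundles using (_↣_; mk↣; Injection)
open import Function.Properties.Inverse using (↔-sym; ↔⇒↣)
open import Relation.Binary.Core using (_Preserves_⟶_)
open import Relation.Binary.PropositionalEquality using (_≡_; _≢_; refl; sym; trans; cong; cong₂; module ≡-Reasoning)
open import Relation.Nullary using (¬_; yes; no; does; contradiction)
open import Relation.Nullary.Decidable using (dec-true; dec-false)

-- Step i leaves the pivot row and, in the rows below it, column i unchanged off the
-- diagonal (the pivot is cleared before row i is added). So from the result one can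
-- read off which rows received which row, and undo the step: off the diagonal, every
-- step and hence d is injective, and on regular matrices (whose diagonal is known) d
-- is injective. d also produces regular matrices. Having finitely many values, the
-- orbit of M repeats, and injectivity pulls the first repetition back to M itself.

xor-cancelʳ : ∀ x y c → x xor c ≡ y xor c → x ≡ y
xor-cancelʳ x y c e = begin
  x               ≡⟨ cancel x ⟨
  (x xor c) xor c ≡⟨ cong (_xor c) e ⟩
  (y xor c) xor c ≡⟨ cancel y ⟩
  y               ∎
  where
  open ≡-Reasoning
  cancel : ∀ z → (z xor c) xor c ≡ z
  cancel z = trans (xor-assoc z c c) (trans (cong (z xor_) (xor-same c)) (xor-identityʳ z))

lookup-conditionalAddRow : ∀ {m} (b c : Bool) (r s : Vec Bool m) l →
  lookup (if b then (if c then addRow r s else r) else r) l ≡ lookup r l xor (b ∧ c ∧ lookup s l)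
lookup-conditionalAddRow true  true  r s l = lookup-zipWith _xor_ l r s
lookup-conditionalAddRow true  false r s l = sym (xor-identityʳ _)
lookup-conditionalAddRow false c     r s l = sym (xor-identityʳ _)

module _ {n : ℕ} where

  entry-setEntry-same : ∀ (D : Matrix n) i j b → entry (setEntry D i j b) i j ≡ b
  entry-setEntry-same D i j b =
    trans (cong (λ r → lookup r j) (lookup∘update i D _)) (lookup∘update j (lookup D i) b)

  entry-setEntry-other : ∀ (D : Matrix n) i j b {k l} → k ≢ i ⊎ l ≢ j →
    entry (setEntry D i j b) k l ≡ entry D k l
  entry-setEntry-other D i j b {k} {l} k≢i⊎l≢j with k ≟ᶠ i | k≢i⊎l≢j
  ... | no k≢i    | _        = cong (λ r → lookup r l) (lookup∘update′ k≢i D _)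
  ... | yes refl  | inj₁ k≢i = contradiction refl k≢i
  ... | yes refl  | inj₂ l≢j =
    trans (cong (λ r → lookup r l) (lookup∘update k D _)) (lookup∘update′ l≢j (lookup D k) b)

  entry-ext : ∀ (A B : Matrix n) → (∀ k l → entry A k l ≡ entry B k l) → A ≡ B
  entry-ext A B same = Pointwise-≡⇒≡ (ext λ k → Pointwise-≡⇒≡ (ext (same k)))

  entry-eliminateBelow : ∀ (D : Matrix n) i k l →
    entry (eliminateBelow D i) k l ≡ entry D k l xor (does (toℕ i <? toℕ k) ∧ entry D k i ∧ entry D i l)
  entry-eliminateBelow D i k l =
    trans (cong (λ r → lookup r l) (lookup∘tabulate _ k))
          (lookup-conditionalAddRow (does (toℕ i <? toℕ k)) (entry D k i) (lookup D k) (lookup D i) l)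

  clearPivot : Matrix n → Fin n → Matrix n
  clearPivot D i = setEntry D i i false

  entry-step-notBelow : ∀ (D : Matrix n) i {k l} → ¬ toℕ i < toℕ k → k ≢ i ⊎ l ≢ i →
    entry (step D i) k l ≡ entry D k l
  entry-step-notBelow D i {k} {l} i≮k avoid = begin
    entry (step D i) k l                    ≡⟨ entry-setEntry-other (eliminateBelow D′ i) i i true avoid ⟩
    entry (eliminateBelow D′ i) k l         ≡⟨ entry-eliminateBelow D′ i k l ⟩
    entry D′ k l xor (does (toℕ i <? toℕ k) ∧ entry D′ k i ∧ entry D′ i l)
      ≡⟨ cong (λ b → entry D′ k l xor (b ∧ entry D′ k i ∧ entry D′ i l)) (dec-false (toℕ i <? toℕ k) i≮k) ⟩
    entry D′ k l xor false                  ≡⟨ xor-identityʳ _ ⟩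
    entry D′ k l                            ≡⟨ entry-setEntry-other D i i false avoid ⟩
    entry D k l                             ∎
    where
    open ≡-Reasoning
    D′ = clearPivot D i

  entry-step-below : ∀ (D : Matrix n) i {k} l → toℕ i < toℕ k →
    entry (step D i) k l ≡ entry D k l xor (entry D k i ∧ entry (clearPivot D i) i l)
  entry-step-below D i {k} l i<k = begin
    entry (step D i) k l                    ≡⟨ entry-setEntry-other (eliminateBelow D′ i) i i true (inj₁ k≢i) ⟩
    entry (eliminateBelow D′ i) k l         ≡⟨ entry-eliminateBelow D′ i k l ⟩
    entry D′ k l xor (does (toℕ i <? toℕ k) ∧ entry D′ k i ∧ entry D′ i l)
      ≡⟨ cong (λ b → entry D′ k l xor (b ∧ entry D′ k i ∧ entry D′ i l)) (dec-true (toℕ i <? toℕ k) i<k) ⟩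
    entry D′ k l xor (entry D′ k i ∧ entry D′ i l)
      ≡⟨ cong₂ (λ x c → x xor (c ∧ entry D′ i l)) (entry-setEntry-other D i i false (inj₁ k≢i))
                                                   (entry-setEntry-other D i i false (inj₁ k≢i)) ⟩
    entry D k l xor (entry D k i ∧ entry D′ i l) ∎
    where
    open ≡-Reasoning
    D′ = clearPivot D i
    k≢i : k ≢ i
    k≢i refl = <-irrefl refl i<k

  entry-step-pivot : ∀ (D : Matrix n) i → entry (step D i) i i ≡ true
  entry-step-pivot D i = entry-setEntry-same (eliminateBelow (clearPivot D i) i) i i true

  entry-step-pivotRow : ∀ (D : Matrix n) i {l} → l ≢ i → entry (step D i) i l ≡ entry (clearPivot D i) i l
  entry-step-pivotRow D i {l} l≢i =
    trans (entry-step-notBelow D i (<-irrefl refl) (inj₂ l≢i)) (sym (entry-setEntry-other D i i false (inj₂ l≢i)))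

  entry-step-pivotColumn : ∀ (D : Matrix n) i {k} → toℕ i < toℕ k → entry (step D i) k i ≡ entry D k i
  entry-step-pivotColumn D i {k} i<k = begin
    entry (step D i) k i                                     ≡⟨ entry-step-below D i i i<k ⟩
    entry D k i xor (entry D k i ∧ entry (clearPivot D i) i i) ≡⟨ cong (λ p → entry D k i xor (entry D k i ∧ p)) (entry-setEntry-same D i i false) ⟩
    entry D k i xor (entry D k i ∧ false)                    ≡⟨ cong (entry D k i xor_) (∧-zeroʳ _) ⟩
    entry D k i xor false                                    ≡⟨ xor-identityʳ _ ⟩
    entry D k i                                              ∎
    where open ≡-Reasoning

  _≈_ : Matrix n → Matrix n → Set
  A ≈ B = ∀ {k l} → k ≢ l → entry A k l ≡ entry B k l

  ≈∧regular⇒≡ : ∀ {A B : Matrix n} → Regular A → Regular B → A ≈ B → A ≡ B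
  ≈∧regular⇒≡ {A} {B} regA regB A≈B = entry-ext A B same
    where
    same : ∀ k l → entry A k l ≡ entry B k l
    same k l with k ≟ᶠ l
    ... | yes refl = trans (regA k) (sym (regB k))
    ... | no k≢l   = A≈B k≢l

  step-cancel-≈ : ∀ (A B : Matrix n) i → step A i ≈ step B i → A ≈ B
  step-cancel-≈ A B i same {k} {l} k≢l with toℕ i <? toℕ k
  ... | no i≮k = begin
    entry A k l          ≡⟨ entry-step-notBelow A i i≮k avoid ⟨
    entry (step A i) k l ≡⟨ same k≢l ⟩
    entry (step B i) k l ≡⟨ entry-step-notBelow B i i≮k avoid ⟩
    entry B k l          ∎
    where
    open ≡-Reasoning
    avoid : k ≢ i ⊎ l ≢ i
    avoid with k ≟ᶠ i
    ... | yes refl = inj₂ λ l≡k → k≢l (sym l≡k)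
    ... | no k≢i   = inj₁ k≢i
  ... | yes i<k = xor-cancelʳ _ _ _ (begin
    entry A k l xor (entry A k i ∧ pivotRow A l) ≡⟨ entry-step-below A i l i<k ⟨
    entry (step A i) k l                         ≡⟨ same k≢l ⟩
    entry (step B i) k l                         ≡⟨ entry-step-below B i l i<k ⟩
    entry B k l xor (entry B k i ∧ pivotRow B l) ≡⟨ cong₂ (λ c p → entry B k l xor (c ∧ p)) (sym sameColumn) (sym sameRow) ⟩
    entry B k l xor (entry A k i ∧ pivotRow A l) ∎)
    where
    open ≡-Reasoning
    pivotRow : Matrix n → Fin n → Bool
    pivotRow D = entry (clearPivot D i) i
    k≢i : k ≢ i
    k≢i refl = <-irrefl refl i<k
    sameColumn : entry A k i ≡ entry B k i
    sameColumn = trans (sym (entry-step-pivotColumn A i i<k)) (trans (same k≢i) (entry-step-pivotColumn B i i<k))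
    sameRow : pivotRow A l ≡ pivotRow B l
    sameRow with l ≟ᶠ i
    ... | yes refl = trans (entry-setEntry-same A i i false) (sym (entry-setEntry-same B i i false))
    ... | no l≢i   = trans (sym (entry-step-pivotRow A i l≢i))
                       (trans (same (λ i≡l → l≢i (sym i≡l))) (entry-step-pivotRow B i l≢i))

  steps : ∀ {m} → Matrix n → Vec (Fin n) m → Matrix n
  steps = foldl (λ _ → Matrix n) step

  steps-cancel-≈ : ∀ {m} (is : Vec (Fin n) m) (A B : Matrix n) → steps A is ≈ steps B is → A ≈ B
  steps-cancel-≈ []       A B same = same
  steps-cancel-≈ (i ∷ is) A B same = step-cancel-≈ A B i (steps-cancel-≈ is (step A i) (step B i) same)

  d-injective : ∀ {A B : Matrix n} → Regular A → Regular B → d A ≡ d B → A ≡ B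
  d-injective {A} {B} regA regB dA≡dB =
    ≈∧regular⇒≡ regA regB (steps-cancel-≈ (allFin n) A B λ {k} {l} _ → cong (λ D → entry D k l) dA≡dB)

  step-keepsEarlierDiagonal : ∀ (D : Matrix n) {i j} → toℕ i < toℕ j → entry (step D j) i i ≡ entry D i i
  step-keepsEarlierDiagonal D {i} {j} i<j = entry-step-notBelow D j (<-asym i<j) (inj₁ i≢j)
    where
    i≢j : i ≢ j
    i≢j refl = <-irrefl refl i<j

  steps-keepEarlierDiagonal : ∀ {m} (D : Matrix n) {i} (g : Fin m → Fin n) → (∀ y → toℕ i < toℕ (g y)) →
    entry (steps D (tabulate g)) i i ≡ entry D i i
  steps-keepEarlierDiagonal {zero}  D g later = refl
  steps-keepEarlierDiagonal {suc m} D g later =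
    trans (steps-keepEarlierDiagonal (step D (g Fin.zero)) (g ∘ Fin.suc) (later ∘ Fin.suc))
          (step-keepsEarlierDiagonal D (later Fin.zero))

  steps-increasing-pivots : ∀ {m} (f : Fin m → Fin n) → f Preserves _<ᶠ_ ⟶ _<ᶠ_ →
    ∀ (D : Matrix n) x → entry (steps D (tabulate f)) (f x) (f x) ≡ true
  steps-increasing-pivots f increasing D Fin.zero =
    trans (steps-keepEarlierDiagonal (step D (f Fin.zero)) (f ∘ Fin.suc) (λ y → increasing (s≤s z≤n)))
          (entry-step-pivot D (f Fin.zero))
  steps-increasing-pivots f increasing D (Fin.suc x) =
    steps-increasing-pivots (f ∘ Fin.suc) (λ x<y → increasing (s≤s x<y)) (step D (f Fin.zero)) x

  d-regular : ∀ (D : Matrix n) → Regular (d D)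
  d-regular = steps-increasing-pivots id id

Vec↣ : ∀ {A : Set} {k m} → A ↣ Fin k → Vec A m ↣ Fin (k ^ m)
Vec↣ {A} {k} {m} A↣Fin = mk↣ {to = encode} encode-injective
  where
  open Injection A↣Fin using (to; injective)
  encode : Vec A m → Fin (k ^ m)
  encode xs = funToFin (to ∘ lookup xs)
  encode-injective : ∀ {xs ys} → encode xs ≡ encode ys → xs ≡ ys
  encode-injective {xs} {ys} e = Pointwise-≡⇒≡ (ext λ i → injective (begin
    to (lookup xs i)                 ≡⟨ finToFun-funToFin (to ∘ lookup xs) i ⟨
    finToFun (encode xs) i           ≡⟨ cong (λ c → finToFun c i) e ⟩
    finToFun (encode ys) i           ≡⟨ finToFun-funToFin (to ∘ lookup ys) i ⟩
    to (lookup ys i)                 ∎))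
    where open ≡-Reasoning

Matrix↣ : ∀ {n} → Matrix n ↣ Fin ((2 ^ n) ^ n)
Matrix↣ = Vec↣ (Vec↣ (↔⇒↣ (↔-sym 2↔Bool)))

sequence-repeats : ∀ {X : Set} {N} → X ↣ Fin N → (s : ℕ → X) → ∃₂ λ a b → a < b × s a ≡ s b
sequence-repeats {N = N} X↣Fin s
  with i , j , i<j , e ← pigeonhole (n<1+n N) (Injection.to X↣Fin ∘ s ∘ toℕ)
  = toℕ i , toℕ j , i<j , Injection.injective X↣Fin e

iterate-regular : ∀ {n} {M : Matrix n} → Regular M → ∀ t → Regular (iterate t M)
iterate-regular regM zero    = regM
iterate-regular regM (suc t) = d-regular _

iterate-returns : ∀ {n} {M : Matrix n} → Regular M → ∀ {a b} → a < b → iterate a M ≡ iterate b M →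
  ∃ λ q → q ≥ 1 × iterate q M ≡ M
iterate-returns regM {zero}  {suc b} _         M≡ = suc b , s≤s z≤n , sym M≡
iterate-returns regM {suc a} {suc b} (s≤s a<b) e  =
  iterate-returns regM a<b (d-injective (iterate-regular regM a) (iterate-regular regM b) e)

mainTheorem3 : (n : ℕ) (M : Matrix n) → Regular M →
    ∃ λ q → q ≥ 1 × iterate q M ≡ M
mainTheorem3 n M regM =
  let a , b , a<b , e = sequence-repeats Matrix↣ (λ t → iterate t M)
  in iterate-returns regM a<b e
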